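{- There is an absolute constant $C>0$ such that for all integers $n>k\ge1$ and every set $S$ with $|S|=4kn$, the number of sequences $(A_1,\dots,A_n)$ of subsets of $S$ satisfying (P1) $|A_1|\le|A_2|\le\dots\le|A_n|$ and (P2) $|A_i\setminus A_{i+1}|\le k-1$ for all $1\le i\le n-1$, is at most $e^{Ckn\log n}$. -}

module Defs where

open import Data.Nat using (ℕ; zero; suc; _≤_; _∸_; _≤?_)
open import Data.Bool using (Bool; true; false)
open import Data.Fin.Subset using (Subset; inside; outside; ∣_∣; _─_)
open import Data.Vec using (Vec; []; _∷_)
open import Data.List using (List; []; _∷_; [_]; map; _++_; concatMap; filter; length)
open import Data.Product using (_×_)
open import Data.Unit using (⊤)
open import Relation.Nullary using (Dec; yes; no)
open import Relation.Nullary.Decidable using (_×-dec_)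
open import Relation.Unary using (Decidable)

allSubsets : (m : ℕ) → List (Subset m)
allSubsets zero = [ [] ]
allSubsets (suc m) = map (outside ∷_) (allSubsets m) ++ map (inside ∷_) (allSubsets m)

allSeqs : (m n : ℕ) → List (Vec (Subset m) n)
allSeqs m zero = [ [] ]
allSeqs m (suc n) = concatMap (λ A → map (A ∷_) (allSeqs m n)) (allSubsets m)

Good : {m n : ℕ} (k : ℕ) → Vec (Subset m) n → Set
Good k [] = ⊤
Good k (A ∷ []) = ⊤
Good k (A ∷ B ∷ rest) = (∣ A ∣ ≤ ∣ B ∣ × ∣ A ─ B ∣ ≤ k ∸ 1) × Good k (B ∷ rest)

good? : {m n : ℕ} (k : ℕ) → Decidable (Good {m} {n} k)
good? k [] = yes _
good? k (A ∷ []) = yes _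
good? k (A ∷ B ∷ rest) = ((∣ A ∣ ≤? ∣ B ∣) ×-dec (∣ A ─ B ∣ ≤? k ∸ 1)) ×-dec good? k (B ∷ rest)

count : (m n k : ℕ) → ℕ
count m n k = length (filter (good? k) (allSeqs m n))

module Submission where

-- Counting sequences A₁,…,Aₙ of subsets of an m-element set in which every step
-- Aᵢ → Aᵢ₊₁ deletes at most j = k - 1 points (property (P2)).  The argument is a weighted transfer bound.
--
-- Give a set B the weight Q^(number of points outside B).  For a fixed A, the total
-- weight of the sets B reachable from A in one step is at most
-- (Q + 1)^|∁A| · (|A|·Q + 1)^j  (each outside point may or may not be added, each
-- deletion costs a factor Q), and for 2m ≤ Q this is at most c · weight A with
-- c = 2 (mQ + 1)^j.  By induction on the length, the number of admissible sequences
-- starting at A is at most cⁿ · weight A, so the total count is at most 2^m · cⁿ · Q^m.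
-- Choosing m = 4kn and Q = n⁵ turns this into n^(34kn).

open import Defs
open import Data.Nat using (ℕ; _≤_; _<_; _*_; _^_)
open import Data.Product using (∃-syntax; _×_)

open import Data.Nat using (zero; suc; _+_; _∸_; z≤n; s≤s; _≤?_; NonZero)
open import Data.Nat.Properties
open import Data.Nat.Tactic.RingSolver using (solve-∀)
open import Data.Bool using (Bool)
open import Data.Fin.Subset using (Subset; inside; outside; ∣_∣; ∁; _─_)
open import Data.Fin.Subset.Properties using (∣p∣≤n)
open import Data.Vec as Vec using (Vec; _∷_)
open import Data.List using (List; []; _∷_; map; _++_; concatMap; filter; length)
open import Data.List.Properties using (length-++; length-map; filter-++; filter-none; map-concatMap)
open import Data.List.Relation.Unary.All using (All; universal)
open import Data.List.Relation.Unary.All.Properties using (map⁺)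
open import Data.Product using (_,_; proj₁; proj₂)
open import Relation.Nullary using (¬_; yes; no; contradiction)
open import Relation.Unary using (Decidable)
open import Relation.Binary.PropositionalEquality
open import Algebra.Properties.CommutativeSemigroup *-commutativeSemigroup using (x∙yz≈y∙xz)

∑ : {X : Set} → (X → ℕ) → List X → ℕ
∑ f []       = 0
∑ f (x ∷ xs) = f x + ∑ f xs

∑-++ : {X : Set} (f : X → ℕ) (xs ys : List X) → ∑ f (xs ++ ys) ≡ ∑ f xs + ∑ f ys
∑-++ f []       ys = refl
∑-++ f (x ∷ xs) ys = trans (cong (f x +_) (∑-++ f xs ys)) (sym (+-assoc (f x) _ _))

∑-map : {X Y : Set} (f : Y → ℕ) (g : X → Y) (xs : List X) → ∑ f (map g xs) ≡ ∑ (λ x → f (g x)) xs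
∑-map f g []       = refl
∑-map f g (x ∷ xs) = cong (f (g x) +_) (∑-map f g xs)

∑-mono : {X : Set} {f g : X → ℕ} → (∀ x → f x ≤ g x) → (xs : List X) → ∑ f xs ≤ ∑ g xs
∑-mono f≤g []       = z≤n
∑-mono f≤g (x ∷ xs) = +-mono-≤ (f≤g x) (∑-mono f≤g xs)

∑-zero : {X : Set} (xs : List X) → ∑ (λ _ → 0) xs ≡ 0
∑-zero []       = refl
∑-zero (x ∷ xs) = ∑-zero xs

∑-pull : {X : Set} (c : ℕ) (a b : X → ℕ) (xs : List X) →
         ∑ (λ x → a x * (c * b x)) xs ≡ c * ∑ (λ x → a x * b x) xs
∑-pull c a b []       = sym (*-zeroʳ c)
∑-pull c a b (x ∷ xs) = trans (cong₂ _+_ (x∙yz≈y∙xz (a x) c (b x)) (∑-pull c a b xs))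
                              (sym (*-distribˡ-+ c (a x * b x) _))

∑-≤-length : {X : Set} {f : X → ℕ} {b : ℕ} → (∀ x → f x ≤ b) → (xs : List X) → ∑ f xs ≤ length xs * b
∑-≤-length f≤b []       = z≤n
∑-≤-length f≤b (x ∷ xs) = +-mono-≤ (f≤b x) (∑-≤-length f≤b xs)

#-concatMap : {X Y : Set} {P : Y → Set} (P? : Decidable P) (g : X → List Y) (xs : List X) →
              length (filter P? (concatMap g xs)) ≡ ∑ (λ x → length (filter P? (g x))) xs
#-concatMap P? g []       = refl
#-concatMap P? g (x ∷ xs) = begin
    length (filter P? (g x ++ concatMap g xs))
  ≡⟨ cong length (filter-++ P? (g x) (concatMap g xs)) ⟩
    length (filter P? (g x) ++ filter P? (concatMap g xs))
  ≡⟨ length-++ (filter P? (g x)) ⟩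
    length (filter P? (g x)) + length (filter P? (concatMap g xs))
  ≡⟨ cong (length (filter P? (g x)) +_) (#-concatMap P? g xs) ⟩
    ∑ (λ x → length (filter P? (g x))) (x ∷ xs) ∎
  where open ≡-Reasoning

#-map-≤ : {X Y : Set} {P : X → Set} {R : Y → Set} (P? : Decidable P) (R? : Decidable R)
          (f : Y → X) → (∀ y → P (f y) → R y) → (ys : List Y) →
          length (filter P? (map f ys)) ≤ length (filter R? ys)
#-map-≤ P? R? f P⇒R []       = z≤n
#-map-≤ P? R? f P⇒R (y ∷ ys) with P? (f y) | R? y
... | yes p | yes _ = s≤s (#-map-≤ P? R? f P⇒R ys)
... | yes p | no ¬r = contradiction (P⇒R y p) ¬r
... | no _  | yes _ = m≤n⇒m≤1+n (#-map-≤ P? R? f P⇒R ys)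
... | no _  | no _  = #-map-≤ P? R? f P⇒R ys

allSubsets-length : (m : ℕ) → length (allSubsets m) ≡ 2 ^ m
allSubsets-length zero    = refl
allSubsets-length (suc m) = begin
    length (map (outside ∷_) (allSubsets m) ++ map (inside ∷_) (allSubsets m))
  ≡⟨ length-++ (map (outside ∷_) (allSubsets m)) ⟩
    length (map (outside ∷_) (allSubsets m)) + length (map (inside ∷_) (allSubsets m))
  ≡⟨ cong₂ _+_ (length-map (outside ∷_) (allSubsets m)) (length-map (inside ∷_) (allSubsets m)) ⟩
    length (allSubsets m) + length (allSubsets m)
  ≡⟨ cong₂ _+_ (allSubsets-length m) (trans (allSubsets-length m) (sym (*-identityˡ (2 ^ m)))) ⟩
    2 ^ suc m ∎
  where open ≡-Reasoning

∑-allSubsets-suc : {m : ℕ} (f : Subset (suc m) → ℕ) →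
                   ∑ f (allSubsets (suc m)) ≡
                   ∑ (λ B → f (outside ∷ B)) (allSubsets m) + ∑ (λ B → f (inside ∷ B)) (allSubsets m)
∑-allSubsets-suc {m} f =
  trans (∑-++ f (map (outside ∷_) (allSubsets m)) (map (inside ∷_) (allSubsets m)))
        (cong₂ _+_ (∑-map f (outside ∷_) (allSubsets m)) (∑-map f (inside ∷_) (allSubsets m)))

-- 𝟙[ d ≤ j ] is 1 if d ≤ j and 0 otherwise.  It follows the recursion of _≤_, so it
-- computes along the pointwise recursion on subsets.
𝟙[_≤_] : ℕ → ℕ → ℕ
𝟙[ zero  ≤ j     ] = 1
𝟙[ suc d ≤ zero  ] = 0
𝟙[ suc d ≤ suc j ] = 𝟙[ d ≤ j ]

𝟙-yes : ∀ {d j} → d ≤ j → 𝟙[ d ≤ j ] ≡ 1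
𝟙-yes z≤n       = refl
𝟙-yes (s≤s d≤j) = 𝟙-yes d≤j

module WeightedNeighbourhood (Q : ℕ) where

  weight : {m : ℕ} → Subset m → ℕ
  weight B = Q ^ ∣ ∁ B ∣

  neighbourhood : {m : ℕ} → ℕ → Subset m → ℕ
  neighbourhood {m} j A = ∑ (λ B → 𝟙[ ∣ A ─ B ∣ ≤ j ] * weight B) (allSubsets m)

  neighbourhood-∷ : {m : ℕ} (j : ℕ) (a : Bool) (A : Subset m) →
    neighbourhood j (a ∷ A) ≡
      ∑ (λ B → 𝟙[ ∣ (a ∷ A) ─ (outside ∷ B) ∣ ≤ j ] * (Q * weight B)) (allSubsets m)
      + ∑ (λ B → 𝟙[ ∣ (a ∷ A) ─ (inside ∷ B) ∣ ≤ j ] * weight B) (allSubsets m)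
  neighbourhood-∷ j a A = ∑-allSubsets-suc (λ B → 𝟙[ ∣ (a ∷ A) ─ B ∣ ≤ j ] * weight B)

  -- A point outside A contributes a factor Q + 1; each of the at most j deletions is one
  -- of the |A| points of A and costs a factor Q.
  neighbourhood-bound : {m : ℕ} (j : ℕ) (A : Subset m) →
                        neighbourhood j A ≤ suc Q ^ ∣ ∁ A ∣ * (∣ A ∣ * Q + 1) ^ j
  neighbourhood-bound j Vec.[] rewrite ^-zeroˡ j = ≤-refl
  neighbourhood-bound {suc m} j (outside ∷ A) = begin
      neighbourhood j (outside ∷ A)
    ≡⟨ neighbourhood-∷ j outside A ⟩
      ∑ (λ B → 𝟙[ ∣ A ─ B ∣ ≤ j ] * (Q * weight B)) (allSubsets m) + neighbourhood j A
    ≡⟨ cong (_+ neighbourhood j A) (∑-pull Q (λ B → 𝟙[ ∣ A ─ B ∣ ≤ j ]) weight (allSubsets m)) ⟩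
      Q * neighbourhood j A + neighbourhood j A
    ≡⟨ +-comm (Q * neighbourhood j A) _ ⟩
      suc Q * neighbourhood j A
    ≤⟨ *-monoʳ-≤ (suc Q) (neighbourhood-bound j A) ⟩
      suc Q * (suc Q ^ ∣ ∁ A ∣ * (∣ A ∣ * Q + 1) ^ j)
    ≡⟨ *-assoc (suc Q) (suc Q ^ ∣ ∁ A ∣) _ ⟨
      suc Q ^ ∣ ∁ (outside ∷ A) ∣ * (∣ outside ∷ A ∣ * Q + 1) ^ j ∎
    where open ≤-Reasoning
  neighbourhood-bound {suc m} zero (inside ∷ A) = begin
      neighbourhood zero (inside ∷ A)
    ≡⟨ neighbourhood-∷ zero inside A ⟩
      ∑ (λ _ → 0) (allSubsets m) + neighbourhood zero A
    ≡⟨ cong (_+ neighbourhood zero A) (∑-zero (allSubsets m)) ⟩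
      neighbourhood zero A
    ≤⟨ neighbourhood-bound zero A ⟩
      suc Q ^ ∣ ∁ (inside ∷ A) ∣ * (∣ inside ∷ A ∣ * Q + 1) ^ zero ∎
    where open ≤-Reasoning
  neighbourhood-bound {suc m} (suc j) (inside ∷ A) = begin
      neighbourhood (suc j) (inside ∷ A)
    ≡⟨ neighbourhood-∷ (suc j) inside A ⟩
      ∑ (λ B → 𝟙[ ∣ A ─ B ∣ ≤ j ] * (Q * weight B)) (allSubsets m) + neighbourhood (suc j) A
    ≡⟨ cong (_+ neighbourhood (suc j) A) (∑-pull Q (λ B → 𝟙[ ∣ A ─ B ∣ ≤ j ]) weight (allSubsets m)) ⟩
      Q * neighbourhood j A + neighbourhood (suc j) A
    ≤⟨ +-mono-≤ (*-monoʳ-≤ Q (neighbourhood-bound j A)) (neighbourhood-bound (suc j) A) ⟩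
      Q * (S * Y ^ j) + S * (Y * Y ^ j)
    ≡⟨ collect Q S ∣ A ∣ (Y ^ j) ⟩
      S * (Y′ * Y ^ j)
    ≤⟨ *-monoʳ-≤ S (*-monoʳ-≤ Y′ (^-monoˡ-≤ j Y≤Y′)) ⟩
      suc Q ^ ∣ ∁ (inside ∷ A) ∣ * (∣ inside ∷ A ∣ * Q + 1) ^ suc j ∎
    where
      open ≤-Reasoning
      S Y Y′ : ℕ
      S  = suc Q ^ ∣ ∁ A ∣
      Y  = ∣ A ∣ * Q + 1
      Y′ = suc ∣ A ∣ * Q + 1
      Y≤Y′ : Y ≤ Y′
      Y≤Y′ = +-monoˡ-≤ 1 (*-monoˡ-≤ Q (n≤1+n ∣ A ∣))
      collect : ∀ Q S a Z → Q * (S * Z) + S * ((a * Q + 1) * Z) ≡ S * (((1 + a) * Q + 1) * Z)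
      collect = solve-∀

-- (Q + 1)^t · u ≤ Q^t · Q when t + u = Q: replacing a factor Q by Q + 1 t times is
-- paid for by shrinking the cofactor from Q to Q - t.
suc-^-deficit : ∀ Q t u → t + u ≡ Q → suc Q ^ t * u ≤ Q ^ t * Q
suc-^-deficit Q zero    u refl = ≤-refl
suc-^-deficit Q (suc t) u t+u≡Q = begin
    (suc Q * suc Q ^ t) * u
  ≡⟨ trans (*-assoc (suc Q) (suc Q ^ t) u) (x∙yz≈y∙xz (suc Q) (suc Q ^ t) u) ⟩
    suc Q ^ t * (suc Q * u)
  ≤⟨ *-monoʳ-≤ (suc Q ^ t) (≤-trans (+-monoˡ-≤ (Q * u) u≤Q) (≤-reflexive (sym (*-suc Q u)))) ⟩
    suc Q ^ t * (Q * suc u)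
  ≡⟨ x∙yz≈y∙xz (suc Q ^ t) Q (suc u) ⟩
    Q * (suc Q ^ t * suc u)
  ≤⟨ *-monoʳ-≤ Q (suc-^-deficit Q t (suc u) (trans (+-suc t u) t+u≡Q)) ⟩
    Q * (Q ^ t * Q)
  ≡⟨ *-assoc Q (Q ^ t) Q ⟨
    (Q * Q ^ t) * Q ∎
  where
    open ≤-Reasoning
    u≤Q : u ≤ Q
    u≤Q = ≤-trans (m≤n+m u (suc t)) (≤-reflexive t+u≡Q)

suc-^-≤-2*^ : ∀ Q .{{_ : NonZero Q}} t → 2 * t ≤ Q → suc Q ^ t ≤ 2 * Q ^ t
suc-^-≤-2*^ Q t 2t≤Q = *-cancelʳ-≤ (suc Q ^ t) (2 * Q ^ t) Q (begin
    suc Q ^ t * Q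
  ≤⟨ *-monoʳ-≤ (suc Q ^ t) Q≤2u ⟩
    suc Q ^ t * (2 * u)
  ≡⟨ x∙yz≈y∙xz (suc Q ^ t) 2 u ⟩
    2 * (suc Q ^ t * u)
  ≤⟨ *-monoʳ-≤ 2 (suc-^-deficit Q t u t+u≡Q) ⟩
    2 * (Q ^ t * Q)
  ≡⟨ *-assoc 2 (Q ^ t) Q ⟨
    2 * Q ^ t * Q ∎)
  where
    open ≤-Reasoning
    u : ℕ
    u = Q ∸ t
    t≤Q : t ≤ Q
    t≤Q = ≤-trans (m≤m+n t (t + 0)) 2t≤Q
    t+u≡Q : t + u ≡ Q
    t+u≡Q = m+[n∸m]≡n t≤Q
    t≤u : t ≤ u
    t≤u = +-cancelˡ-≤ t t u (≤-trans (≤-reflexive (cong (t +_) (sym (+-identityʳ t))))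
                                      (≤-trans 2t≤Q (≤-reflexive (sym t+u≡Q))))
    Q≤2u : Q ≤ 2 * u
    Q≤2u = ≤-trans (≤-reflexive (sym t+u≡Q)) (+-mono-≤ t≤u (m≤m+n u 0))

Good-tail : ∀ {m n} k (A : Subset m) (As : Vec (Subset m) (suc n)) → Good k (A ∷ As) → Good k As
Good-tail k A (B ∷ As) = proj₂

module Transfer (m k Q : ℕ) .{{_ : NonZero Q}} (2m≤Q : 2 * m ≤ Q) where
  open WeightedNeighbourhood Q

  j : ℕ
  j = k ∸ 1

  c : ℕ
  c = 2 * (m * Q + 1) ^ j

  goodFrom : ℕ → Subset m → ℕ
  goodFrom n A = length (filter (good? k) (map (A ∷_) (allSeqs m n)))

  goodFrom-pair : ∀ n (A B : Subset m) →
                  length (filter (good? k) (map (A ∷_) (map (B ∷_) (allSeqs m n))))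
                    ≤ 𝟙[ ∣ A ─ B ∣ ≤ j ] * goodFrom n B
  goodFrom-pair n A B with ∣ A ─ B ∣ ≤? j
  ... | yes A─B≤j rewrite 𝟙-yes A─B≤j =
    ≤-trans (#-map-≤ (good? k) (good? k) (A ∷_) (Good-tail k A) (map (B ∷_) (allSeqs m n)))
            (≤-reflexive (sym (*-identityˡ _)))
  ... | no A─B≰j = ≤-trans (≤-reflexive (cong length (filter-none (good? k) noneGood))) z≤n
    where
      noneGood : All (λ As → ¬ Good k As) (map (A ∷_) (map (B ∷_) (allSeqs m n)))
      noneGood = map⁺ (map⁺ (universal (λ _ good → A─B≰j (proj₂ (proj₁ good))) (allSeqs m n)))

  goodFrom-step : ∀ n (A : Subset m) →
                  goodFrom (suc n) A ≤ ∑ (λ B → 𝟙[ ∣ A ─ B ∣ ≤ j ] * goodFrom n B) (allSubsets m)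
  goodFrom-step n A = begin
      goodFrom (suc n) A
    ≡⟨ cong (λ xs → length (filter (good? k) xs))
            (map-concatMap (A ∷_) (λ B → map (B ∷_) (allSeqs m n)) (allSubsets m)) ⟩
      length (filter (good? k) (concatMap (λ B → map (A ∷_) (map (B ∷_) (allSeqs m n))) (allSubsets m)))
    ≡⟨ #-concatMap (good? k) (λ B → map (A ∷_) (map (B ∷_) (allSeqs m n))) (allSubsets m) ⟩
      ∑ (λ B → length (filter (good? k) (map (A ∷_) (map (B ∷_) (allSeqs m n))))) (allSubsets m)
    ≤⟨ ∑-mono (goodFrom-pair n A) (allSubsets m) ⟩
      ∑ (λ B → 𝟙[ ∣ A ─ B ∣ ≤ j ] * goodFrom n B) (allSubsets m) ∎
    where open ≤-Reasoning

  -- The one-step estimate with the room 2m ≤ Q: (Q + 1)^|∁A| ≤ 2 Q^|∁A| and |A| ≤ m.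
  neighbourhood-≤ : (A : Subset m) → neighbourhood j A ≤ c * weight A
  neighbourhood-≤ A = begin
      neighbourhood j A
    ≤⟨ neighbourhood-bound j A ⟩
      suc Q ^ ∣ ∁ A ∣ * (∣ A ∣ * Q + 1) ^ j
    ≤⟨ *-mono-≤ (suc-^-≤-2*^ Q ∣ ∁ A ∣ (≤-trans (*-monoʳ-≤ 2 (∣p∣≤n (∁ A))) 2m≤Q))
                (^-monoˡ-≤ j (+-monoˡ-≤ 1 (*-monoˡ-≤ Q (∣p∣≤n A)))) ⟩
      2 * weight A * (m * Q + 1) ^ j
    ≡⟨ trans (*-assoc 2 (weight A) Y) (trans (cong (2 *_) (*-comm (weight A) Y)) (sym (*-assoc 2 Y (weight A)))) ⟩
      c * weight A ∎
    where
      open ≤-Reasoning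
      Y : ℕ
      Y = (m * Q + 1) ^ j

  goodFrom-≤ : ∀ n (A : Subset m) → goodFrom n A ≤ c ^ n * weight A
  goodFrom-≤ zero    A = ≤-trans (m^n>0 Q ∣ ∁ A ∣) (≤-reflexive (sym (*-identityˡ (weight A))))
  goodFrom-≤ (suc n) A = begin
      goodFrom (suc n) A
    ≤⟨ goodFrom-step n A ⟩
      ∑ (λ B → 𝟙[ ∣ A ─ B ∣ ≤ j ] * goodFrom n B) (allSubsets m)
    ≤⟨ ∑-mono (λ B → *-monoʳ-≤ 𝟙[ ∣ A ─ B ∣ ≤ j ] (goodFrom-≤ n B)) (allSubsets m) ⟩
      ∑ (λ B → 𝟙[ ∣ A ─ B ∣ ≤ j ] * (c ^ n * weight B)) (allSubsets m)
    ≡⟨ ∑-pull (c ^ n) (λ B → 𝟙[ ∣ A ─ B ∣ ≤ j ]) weight (allSubsets m) ⟩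
      c ^ n * neighbourhood j A
    ≤⟨ *-monoʳ-≤ (c ^ n) (neighbourhood-≤ A) ⟩
      c ^ n * (c * weight A)
    ≡⟨ trans (x∙yz≈y∙xz (c ^ n) c (weight A)) (sym (*-assoc c (c ^ n) (weight A))) ⟩
      c ^ suc n * weight A ∎
    where open ≤-Reasoning

  -- Summing over the first set, each of weight at most Q^m.
  count-≤ : ∀ n → count m (suc n) k ≤ 2 ^ m * (c ^ n * Q ^ m)
  count-≤ n = begin
      count m (suc n) k
    ≡⟨ #-concatMap (good? k) (λ A → map (A ∷_) (allSeqs m n)) (allSubsets m) ⟩
      ∑ (goodFrom n) (allSubsets m)
    ≤⟨ ∑-≤-length (λ A → ≤-trans (goodFrom-≤ n A) (*-monoʳ-≤ (c ^ n) (^-monoʳ-≤ Q (∣p∣≤n (∁ A)))))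
                  (allSubsets m) ⟩
      length (allSubsets m) * (c ^ n * Q ^ m)
    ≡⟨ cong (_* (c ^ n * Q ^ m)) (allSubsets-length m) ⟩
      2 ^ m * (c ^ n * Q ^ m) ∎
    where open ≤-Reasoning

suc-≤-* : ∀ {n x} → 2 ≤ n → 1 ≤ x → suc x ≤ n * x
suc-≤-* {n} {x} 2≤n 1≤x = ≤-trans (+-monoˡ-≤ x 1≤x)
                                  (≤-trans (≤-reflexive (cong (x +_) (sym (+-identityʳ x)))) (*-monoˡ-≤ x 2≤n))

^-≤-^ : ∀ {x n} a b → x ≤ n ^ a → x ^ b ≤ n ^ (a * b)
^-≤-^ {n = n} a b x≤nᵃ = ≤-trans (^-monoˡ-≤ b x≤nᵃ) (≤-reflexive (^-*-assoc n a b))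

-- The theorem with C = 34: apply the transfer bound with m = 4kn and Q = n⁵.
count-≤-power : ∀ n k → 1 ≤ k → k < n → count (4 * k * n) n k ≤ n ^ (34 * k * n)
count-≤-power zero     k        _  ()
count-≤-power (suc n′) zero     () _
count-≤-power (suc n′) (suc k′) _  (s≤s k≤n′) = begin
    count m n k
  ≤⟨ count-≤ n′ ⟩
    2 ^ m * (c ^ n′ * Q ^ m)
  ≤⟨ *-mono-≤ (^-monoˡ-≤ m 2≤n) (*-mono-≤ cⁿ′≤ (≤-reflexive (^-*-assoc n 5 m))) ⟩
    n ^ m * (n ^ (10 * k * n) * n ^ (5 * m))
  ≡⟨ trans (^-distribˡ-+-* n m _) (cong (n ^ m *_) (^-distribˡ-+-* n (10 * k * n) (5 * m))) ⟨
    n ^ (m + (10 * k * n + 5 * m))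
  ≡⟨ cong (n ^_) (exponent k n) ⟩
    n ^ (34 * k * n) ∎
  where
    open ≤-Reasoning
    n k m Q : ℕ
    n = suc n′
    k = suc k′
    m = 4 * k * n
    Q = n ^ 5
    2≤n : 2 ≤ n
    2≤n = s≤s (≤-trans (s≤s z≤n) k≤n′)
    n⁴ : ∀ x → x * x * x * x ≡ x * (x * (x * (x * 1)))
    n⁴ = solve-∀
    -- m = 4kn ≤ n · n · n · n since 4 ≤ n · n and k ≤ n; hence 2m ≤ n⁵ = Q.
    m≤n⁴ : m ≤ n ^ 4
    m≤n⁴ = ≤-trans (*-monoˡ-≤ n (*-mono-≤ (*-mono-≤ 2≤n 2≤n) (m≤n⇒m≤1+n k≤n′))) (≤-reflexive (n⁴ n))
    open Transfer m k Q (*-mono-≤ 2≤n m≤n⁴)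
    mQ+1≤n¹⁰ : m * Q + 1 ≤ n ^ 10
    mQ+1≤n¹⁰ = ≤-trans (≤-reflexive (+-comm (m * Q) 1))
               (≤-trans (s≤s (≤-trans (*-monoˡ-≤ Q m≤n⁴) (≤-reflexive (sym (^-distribˡ-+-* n 4 5)))))
                        (suc-≤-* 2≤n (m^n>0 n 9)))
    c≤ : c ≤ n ^ (10 * k)
    c≤ = ≤-trans (*-mono-≤ (*-mono-≤ 2≤n (m^n>0 n 9)) (^-monoˡ-≤ k′ mQ+1≤n¹⁰))
                 (≤-reflexive (^-*-assoc n 10 k))
    cⁿ′≤ : c ^ n′ ≤ n ^ (10 * k * n)
    cⁿ′≤ = ≤-trans (^-≤-^ (10 * k) n′ c≤) (^-monoʳ-≤ n (*-monoʳ-≤ (10 * k) (n≤1+n n′)))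
    exponent : ∀ a b → 4 * a * b + (10 * a * b + 5 * (4 * a * b)) ≡ 34 * a * b
    exponent = solve-∀

claim1 : ∃[ C ] (1 ≤ C × (∀ (n k : ℕ) → 1 ≤ k → k < n → count (4 * k * n) n k ≤ n ^ (C * k * n)))
claim1 = 34 , s≤s z≤n , count-≤-power
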